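{- Let $G$ be any graph and $(\mathcal{T},\{X_t\})$ a rooted tree decomposition of $G$. Let $t\in V(\mathcal{T})$ be a bag and let $P$ be a path in $G$ of length at least $2$ whose endpoints $x,y$ are the only vertices of $P$ in $X_t$, that is, $V(P)\cap X_t\subseteq\{x,y\}$. Then there is a connected component $\mathcal{T}'$ of $\mathcal{T}\setminus t$ such that every edge $ab\in E(P)$ belongs to $E_{t'}$ for some bag $t'\in V(\mathcal{T}')$.
   Context: A tree decomposition of $G$ is a tree $\mathcal{T}$ with bags $X_t\subseteq V(G)$ such that every vertex lies in some bag, every edge has both endpoints in some bag, and for each vertex the nodes whose bags contain it induce a connected subtree of $\mathcal{T}$. The tree is rooted; an edge $uv$ appears in bag $t$ if $t$ is the topmost (closest to the root) bag containing both $u$ and $v$, and $E_t$ denotes the set of edges appearing in $t$. $\mathcal{T}\setminus t$ is the forest obtained by deleting node $t$ from $\mathcal{T}$. -}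

module Defs where

open import Data.Nat using (ℕ; zero; suc; _≤_)
open import Data.Fin using (Fin)
open import Data.Fin.Subset using (Subset; _∈_)
open import Data.List using (List; []; _∷_; _++_)
open import Data.List.Relation.Unary.Linked using (Linked)
open import Data.List.Relation.Unary.Unique.Propositional using (Unique)
open import Data.Product using (Σ; ∃; _×_)
open import Data.Sum using (_⊎_)
open import Function using (id; _∘_)
open import Relation.Binary.PropositionalEquality using (_≡_; _≢_)
open import Relation.Nullary using (¬_)

record Graph (n : ℕ) : Set₁ where
  field
    Adj       : Fin n → Fin n → Set
    Adj-sym   : ∀ {u v} → Adj u v → Adj v u
    Adj-irrefl : ∀ {u} → ¬ Adj u u

iter : ∀ {A : Set} → (A → A) → ℕ → A → A
iter f zero    = id
iter f (suc k) = f ∘ iter f k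

-- A rooted tree on node set Fin m, given by a root and a parent map in which
-- every node reaches the root by repeatedly taking parents.
-- Its (undirected) edges are {s , parent s} for s ≠ root.
record RootedTree (m : ℕ) : Set where
  field
    root        : Fin m
    parent      : Fin m → Fin m
    parent-root : parent root ≡ root
    reaches     : ∀ s → ∃ λ k → iter parent k s ≡ root

  TAdj : Fin m → Fin m → Set
  TAdj s s' = (s ≢ root × parent s ≡ s') ⊎ (s' ≢ root × parent s' ≡ s)

  -- s is at least as close to the root as s' (distance to root of s ≤ that of s')
  CloserEq : Fin m → Fin m → Set
  CloserEq s s' = ∀ k' → iter parent k' s' ≡ root → ∃ λ k → k ≤ k' × iter parent k s ≡ root

data Walk {A : Set} (R : A → A → Set) (P : A → Set) : A → A → Set where
  [_]  : ∀ {a} → P a → Walk R P a a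
  _∷⟨_⟩_ : ∀ {a b c} → P a → R a b → Walk R P b c → Walk R P a c

record TreeDecomposition {n m : ℕ} (G : Graph n) (T : RootedTree m)
                         (X : Fin m → Subset n) : Set where
  open Graph G
  open RootedTree T
  field
    vertex-cover : ∀ v → ∃ λ s → v ∈ X s
    edge-cover   : ∀ u v → Adj u v → ∃ λ s → u ∈ X s × v ∈ X s
    connected    : ∀ v s s' → v ∈ X s → v ∈ X s' → Walk TAdj (λ r → v ∈ X r) s s'

-- The edge uv appears in node s: s is a topmost (closest to root) node whose
-- bag contains both u and v.
Appears : ∀ {n m} → RootedTree m → (Fin m → Subset n) → Fin n → Fin n → Fin m → Set
Appears T X u v s =
  u ∈ X s × v ∈ X s × (∀ s' → u ∈ X s' → v ∈ X s' → RootedTree.CloserEq T s s')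

-- s and s' lie in the same connected component of T ∖ t
-- (in particular both are different from t).
SameComp : ∀ {m} → RootedTree m → Fin m → Fin m → Fin m → Set
SameComp T t s s' = Walk (RootedTree.TAdj T) (λ r → r ≢ t) s s'

-- (a , b) is a pair of consecutive vertices of the list, i.e. ab is an edge of the path.
data Consec {A : Set} : List A → A → A → Set where
  here  : ∀ {a b l} → Consec (a ∷ b ∷ l) a b
  there : ∀ {a l x y} → Consec l x y → Consec (a ∷ l) x y

IsPath : ∀ {n} → Graph n → List (Fin n) → Set
IsPath G vs = Unique vs × Linked (Graph.Adj G) vs

module Submission where

-- The interior vertices z₁ … zₖ then avoid
-- X t, so for each of them the bags containing it form a subtree of T that
-- avoids t, i.e. lies in a single component of T ∖ t.  Consecutive interior
-- vertices share a bag (edge cover), so all these subtrees lie in ONE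
-- component, the component of some bag s₀ containing z₁.  Every edge ab of
-- P has an interior endpoint (k ≥ 1), and the topmost bag in which ab
-- appears contains that endpoint, hence lies in the component of s₀.

open import Defs
open import Data.Nat using (ℕ; _≤_; zero; suc; z≤n; s≤s)
open import Data.Fin using (Fin; _≟_)
open import Data.Fin.Subset using (Subset; _∈_; _∉_)
open import Data.Fin.Subset.Properties using (_∈?_)
open import Data.Fin.Properties using (any?)
open import Data.List using (List; []; _∷_; _++_; length)
open import Data.List.Membership.Propositional using () renaming (_∈_ to _∈ₗ_)
open import Data.List.Membership.Propositional.Properties using (∈-++⁺ˡ)
open import Data.List.Relation.Unary.Any using (here; there)
open import Data.List.Relation.Unary.All using (All; lookup; tabulate) renaming (_∷_ to _∷ᵃ_)
open import Data.List.Relation.Unary.All.Properties using (++⁻ˡ; ++⁻ʳ)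
open import Data.List.Relation.Unary.AllPairs using () renaming (_∷_ to _∷ᵖ_)
open import Data.List.Relation.Unary.Linked using (Linked) renaming ([] to []ˡ; [-] to [-]ˡ; _∷_ to _∷ˡ_)
open import Data.List.Relation.Unary.Unique.Propositional using (Unique)
open import Data.Product using (∃; _×_; _,_; proj₁; proj₂)
open import Data.Sum using (_⊎_; inj₁; inj₂)
open import Data.Empty using (⊥-elim)
open import Relation.Nullary using (¬_; Dec; yes; no)
open import Relation.Nullary.Decidable using (_×-dec_)
open import Relation.Binary.PropositionalEquality using (_≡_; _≢_; refl)

leastWitness : (Q : ℕ → Set) → (∀ k → Dec (Q k)) → ∀ K → Q K →
               ∃ λ k → Q k × (∀ k' → Q k' → k ≤ k')
leastWitness Q Q? zero qK = zero , qK , λ _ _ → z≤n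
leastWitness Q Q? (suc K) qK with Q? zero
... | yes q₀ = zero , q₀ , λ _ _ → z≤n
... | no ¬q₀ with leastWitness (λ k → Q (suc k)) (λ k → Q? (suc k)) K qK
...   | k , qk , least = suc k , qk , least′
  where
  least′ : ∀ k' → Q k' → suc k ≤ k'
  least′ zero    q = ⊥-elim (¬q₀ q)
  least′ (suc j) q = s≤s (least j q)

topmostBag : ∀ {n m} (T : RootedTree m) (X : Fin m → Subset n) →
             ∀ a b s → a ∈ X s → b ∈ X s → ∃ λ s' → Appears T X a b s'
topmostBag T X a b s a∈s b∈s with RootedTree.reaches T s
... | K , s↝root with leastWitness SharedBagAtDepth sharedBagAtDepth? K (s , a∈s , b∈s , s↝root)
  where
  open RootedTree T
  SharedBagAtDepth : ℕ → Set
  SharedBagAtDepth k = ∃ λ r → a ∈ X r × b ∈ X r × iter parent k r ≡ root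
  sharedBagAtDepth? : ∀ k → Dec (SharedBagAtDepth k)
  sharedBagAtDepth? k =
    any? (λ r → (a ∈? X r) ×-dec ((b ∈? X r) ×-dec (iter parent k r ≟ root)))
... | k , (r , a∈r , b∈r , r↝root) , least =
  r , a∈r , b∈r , λ s' a∈s' b∈s' k' s'↝root →
    k , least k' (s' , a∈s' , b∈s' , s'↝root) , r↝root

module _ {A : Set} {R : A → A → Set} where

  mapWalk : ∀ {P P' : A → Set} → (∀ {a} → P a → P' a) →
            ∀ {a b} → Walk R P a b → Walk R P' a b
  mapWalk f [ p ]        = [ f p ]
  mapWalk f (p ∷⟨ e ⟩ w) = f p ∷⟨ e ⟩ mapWalk f w

  _++ʷ_ : ∀ {P : A → Set} {a b c} → Walk R P a b → Walk R P b c → Walk R P a c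
  [ _ ]        ++ʷ w' = w'
  (p ∷⟨ e ⟩ w) ++ʷ w' = p ∷⟨ e ⟩ (w ++ʷ w')

linked-consec : ∀ {A : Set} {R : A → A → Set} {l a b} → Linked R l → Consec l a b → R a b
linked-consec (r ∷ˡ _) here      = r
linked-consec (_ ∷ˡ L) (there c) = linked-consec L c
linked-consec [-]ˡ     (there ())

module _ {A : Set} where

  interior-≢-ends : ∀ {x y : A} zs → Unique (x ∷ zs ++ y ∷ []) →
                    ∀ {v} → v ∈ₗ zs → v ≢ x × v ≢ y
  interior-≢-ends {x} {y} zs (x∉ ∷ᵖ uniq) v∈zs =
    (λ { refl → lookup (++⁻ˡ zs x∉) v∈zs refl }) , ≢-last zs uniq v∈zs
    where
    ≢-last : ∀ ws → Unique (ws ++ y ∷ []) → ∀ {v} → v ∈ₗ ws → v ≢ y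
    ≢-last (w ∷ ws) (w∉ ∷ᵖ _) (here refl) = lookup (++⁻ʳ ws w∉) (here refl)
    ≢-last (w ∷ ws) (_ ∷ᵖ u)  (there v∈)  = ≢-last ws u v∈

  linked-interior : ∀ {R : A → A → Set} {x y : A} zs →
                    Linked R (x ∷ zs ++ y ∷ []) → Linked R zs
  linked-interior []       _        = []ˡ
  linked-interior (w ∷ ws) (_ ∷ˡ L) = linked-init (w ∷ ws) L
    where
    linked-init : ∀ {R : A → A → Set} {y : A} ws → Linked R (ws ++ y ∷ []) → Linked R ws
    linked-init []           _        = []ˡ
    linked-init (w ∷ [])     _        = [-]ˡ
    linked-init (w ∷ v ∷ ws) (r ∷ˡ L) = r ∷ˡ linked-init (v ∷ ws) L

  consec-meets-interior : ∀ {x y z : A} zs {a b} → Consec (x ∷ (z ∷ zs) ++ y ∷ []) a b →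
                          a ∈ₗ (z ∷ zs) ⊎ b ∈ₗ (z ∷ zs)
  consec-meets-interior zs here      = inj₂ (here refl)
  consec-meets-interior zs (there c) = inj₁ (consec-first (_ ∷ zs) c)
    where
    consec-first : ∀ {y : A} ws {a b} → Consec (ws ++ y ∷ []) a b → a ∈ₗ ws
    consec-first []           (there ())
    consec-first (w ∷ [])     here              = here refl
    consec-first (w ∷ [])     (there (there ()))
    consec-first (w ∷ v ∷ ws) here              = here refl
    consec-first (w ∷ v ∷ ws) (there c)         = there (consec-first (v ∷ ws) c)

module _ {n m} {G : Graph n} {T : RootedTree m} {X : Fin m → Subset n}
         (TD : TreeDecomposition G T X) (t : Fin m) where
  open Graph G
  open TreeDecomposition TD

  bags-of-vertex-connected : ∀ {v} → v ∉ X t → ∀ {r r'} → v ∈ X r → v ∈ X r' →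
                             SameComp T t r r'
  bags-of-vertex-connected {v} v∉t {r} {r'} v∈r v∈r' =
    mapWalk (λ { v∈q refl → v∉t v∈q }) (connected v r r' v∈r v∈r')

  bags-of-path-connected : ∀ {z} zs → Linked Adj (z ∷ zs) → All (_∉ X t) (z ∷ zs) →
                           ∀ {s} → z ∈ X s → ∀ {v r} → v ∈ₗ (z ∷ zs) → v ∈ X r →
                           SameComp T t s r
  bags-of-path-connected _ _ (z∉t ∷ᵃ _) z∈s (here refl) v∈r =
    bags-of-vertex-connected z∉t z∈s v∈r
  bags-of-path-connected {z} (z' ∷ zs) (zz' ∷ˡ L) (z∉t ∷ᵃ avoid) z∈s (there v∈) v∈r
    with edge-cover z z' zz'
  ... | q , z∈q , z'∈q =
    bags-of-vertex-connected z∉t z∈s z∈q ++ʷ bags-of-path-connected zs L avoid z'∈q v∈ v∈r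

lemma10 : ∀ {n m} (G : Graph n) (T : RootedTree m) (X : Fin m → Subset n)
    → TreeDecomposition G T X
    → (t : Fin m) (x y : Fin n) (zs : List (Fin n))
    → 1 ≤ length zs
    → IsPath G (x ∷ zs ++ y ∷ [])
    → (∀ v → v ∈ₗ (x ∷ zs ++ y ∷ []) → v ∈ X t → v ≡ x ⊎ v ≡ y)
    → ∃ λ s → s ≢ t ×
    (∀ a b → Consec (x ∷ zs ++ y ∷ []) a b →
    ∃ λ s' → SameComp T t s s' × Appears T X a b s')
lemma10 G T X TD t x y [] () _ _
lemma10 G T X TD t x y zs@(z ∷ zs') _ (uniq , linked) onlyEnds =
  s₀ , (λ { refl → z∉t z∈s₀ }) , edgeInComponent
  where
  open TreeDecomposition TD

  interiorAvoids : All (_∉ X t) zs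
  interiorAvoids = tabulate λ v∈zs v∈t → case-end (interior-≢-ends zs uniq v∈zs)
                                          (onlyEnds _ (there (∈-++⁺ˡ v∈zs)) v∈t)
    where
    case-end : ∀ {v} → v ≢ x × v ≢ y → ¬ (v ≡ x ⊎ v ≡ y)
    case-end (v≢x , _) (inj₁ v≡x) = v≢x v≡x
    case-end (_ , v≢y) (inj₂ v≡y) = v≢y v≡y

  z∉t : z ∉ X t
  z∉t = lookup interiorAvoids (here refl)

  s₀ : Fin _
  s₀ = proj₁ (vertex-cover z)

  z∈s₀ : z ∈ X s₀
  z∈s₀ = proj₂ (vertex-cover z)

  sameComp : ∀ {v r} → v ∈ₗ zs → v ∈ X r → SameComp T t s₀ r
  sameComp = bags-of-path-connected TD t zs' (linked-interior zs linked) interiorAvoids z∈s₀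

  edgeInComponent : ∀ a b → Consec (x ∷ zs ++ y ∷ []) a b →
                    ∃ λ s' → SameComp T t s₀ s' × Appears T X a b s'
  edgeInComponent a b ab with edge-cover a b (linked-consec linked ab)
  ... | s₁ , a∈s₁ , b∈s₁ with topmostBag T X a b s₁ a∈s₁ b∈s₁
  ... | s' , appears@(a∈s' , b∈s' , _) with consec-meets-interior zs' ab
  ...   | inj₁ a∈zs = s' , sameComp a∈zs a∈s' , appears
  ...   | inj₂ b∈zs = s' , sameComp b∈zs b∈s' , appears
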